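{- In classical propositional logic, let $A$ be a formula and $x$ a variable, and let $\theta^A_x$ be the substitution with $\theta^A_x(x)=A\wedge x$ and $\theta^A_x(y)=y$ for every atom $y\neq x$. Then $x$ is positive in $\theta^A_x(A)$. Furthermore, if a variable $y$ is positive in $A$, then $y$ is also positive in $\theta^A_x(A)$.
   Context: Formulas are built from atoms (variables and parameters) with $\bot,\wedge,\vee,\to$; a substitution commutes with connectives and fixes parameters. Truth values are ordered with falsity below truth. A variable $x$ is positive in $A$ if for all classical interpretations $I,J$ with $I(x)\le J(x)$ and $I(a)=J(a)$ for every atom $a\neq x$, we have $I(A)\le J(A)$. -}

module Defs where

open import Data.Nat using (ℕ; _≟_)
open import Data.Bool using (Bool; true; false; _∧_; _∨_; not; _≤_)
open import Relation.Nullary using (¬_; yes; no)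
open import Relation.Binary.PropositionalEquality using (_≡_)

data Atom : Set where
  var : ℕ → Atom
  par : ℕ → Atom

data Formula : Set where
  atom : Atom → Formula
  ⊥'   : Formula
  _∧'_ : Formula → Formula → Formula
  _∨'_ : Formula → Formula → Formula
  _⇒'_ : Formula → Formula → Formula

Subst : Set
Subst = ℕ → Formula

subst : Subst → Formula → Formula
subst σ (atom (var n)) = σ n
subst σ (atom (par p)) = atom (par p)
subst σ ⊥'             = ⊥'
subst σ (A ∧' B)       = subst σ A ∧' subst σ B
subst σ (A ∨' B)       = subst σ A ∨' subst σ B
subst σ (A ⇒' B)       = subst σ A ⇒' subst σ B

Interp : Set
Interp = Atom → Bool

⟦_⟧ : Formula → Interp → Bool
⟦ atom a ⟧ I = I a
⟦ ⊥' ⟧     I = false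
⟦ A ∧' B ⟧ I = ⟦ A ⟧ I ∧ ⟦ B ⟧ I
⟦ A ∨' B ⟧ I = ⟦ A ⟧ I ∨ ⟦ B ⟧ I
⟦ A ⇒' B ⟧ I = not (⟦ A ⟧ I) ∨ ⟦ B ⟧ I

Positive : ℕ → Formula → Set
Positive x A = (I J : Interp) → I (var x) ≤ J (var x) →
  ((a : Atom) → ¬ (a ≡ var x) → I a ≡ J a) → ⟦ A ⟧ I ≤ ⟦ A ⟧ J

θ : Formula → ℕ → Subst
θ A x y with y ≟ x
... | yes _ = A ∧' atom (var x)
... | no  _ = atom (var y)

-- Classically θ^A_x(A) is equivalent to A[⊥/x] ∨ A: where x is false, θ^A_x
-- does nothing; where x is true, it replaces x by the value of A, and A[A/x]
-- agrees with A when A holds and with A[⊥/x] when it fails.  In terms of the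
-- fibre f b = A[b/x], the value at x = c is f false ∨ f c, which is monotone in
-- c and in f; the first gives positivity of x, the second transports positivity
-- of any other variable y, since then each fibre is positive in y.
module Submission where

open import Defs
open import Data.Nat using (ℕ; _≟_)
open import Data.Product using (_×_; _,_)
open import Data.Bool using (Bool; true; false; _∧_; _∨_; not; _≤_; b≤b; f≤t)
open import Data.Bool.Properties
  using (≤-reflexive; ≤-trans; ≤-minimum; ≤-maximum; ∨-idem; ∨-identityʳ; ∨-zeroʳ; ∧-zeroʳ; ∧-identityʳ)
open import Data.Empty using (⊥-elim)
open import Relation.Nullary using (¬_; yes; no)
open import Relation.Binary.PropositionalEquality
  using (_≡_; _≢_; _≗_; refl; sym; trans; cong; cong₂; subst₂; module ≡-Reasoning)

∨-mono-≤ : {a b c d : Bool} → a ≤ b → c ≤ d → a ∨ c ≤ b ∨ d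
∨-mono-≤ {true}  b≤b _   = b≤b
∨-mono-≤ {false} b≤b c≤d = c≤d
∨-mono-≤ {c = c} f≤t _   = ≤-maximum c

a≤a∨b : (a b : Bool) → a ≤ a ∨ b
a≤a∨b false b = ≤-minimum b
a≤a∨b true  b = b≤b

f[f∧id]≡f[false]∨f : (f : Bool → Bool) (c : Bool) → f (f c ∧ c) ≡ f false ∨ f c
f[f∧id]≡f[false]∨f f false rewrite ∧-zeroʳ (f false) = sym (∨-idem (f false))
f[f∧id]≡f[false]∨f f true rewrite ∧-identityʳ (f true) with f true in eq
... | true  = trans eq (sym (∨-zeroʳ (f false)))
... | false = sym (∨-identityʳ (f false))

f[false]∨f-mono : {f g : Bool → Bool} {c d : Bool} →
  (∀ b → f b ≤ g b) → c ≤ d → f false ∨ f c ≤ g false ∨ g d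
f[false]∨f-mono f≤g b≤b = ∨-mono-≤ (f≤g false) (f≤g _)
f[false]∨f-mono {f} {g} f≤g f≤t rewrite ∨-idem (f false) =
  ≤-trans (f≤g false) (a≤a∨b (g false) (g true))

⟦⟧-cong : (A : Formula) {I J : Interp} → I ≗ J → ⟦ A ⟧ I ≡ ⟦ A ⟧ J
⟦⟧-cong (atom a) I≗J = I≗J a
⟦⟧-cong ⊥'       I≗J = refl
⟦⟧-cong (A ∧' B) I≗J = cong₂ _∧_ (⟦⟧-cong A I≗J) (⟦⟧-cong B I≗J)
⟦⟧-cong (A ∨' B) I≗J = cong₂ _∨_ (⟦⟧-cong A I≗J) (⟦⟧-cong B I≗J)
⟦⟧-cong (A ⇒' B) I≗J = cong₂ (λ a b → not a ∨ b) (⟦⟧-cong A I≗J) (⟦⟧-cong B I≗J)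

_⊙_ : Subst → Interp → Interp
(σ ⊙ I) (var n) = ⟦ σ n ⟧ I
(σ ⊙ I) (par p) = I (par p)

⟦subst⟧ : (σ : Subst) (A : Formula) (I : Interp) → ⟦ subst σ A ⟧ I ≡ ⟦ A ⟧ (σ ⊙ I)
⟦subst⟧ σ (atom (var n)) I = refl
⟦subst⟧ σ (atom (par p)) I = refl
⟦subst⟧ σ ⊥'             I = refl
⟦subst⟧ σ (A ∧' B)       I = cong₂ _∧_ (⟦subst⟧ σ A I) (⟦subst⟧ σ B I)
⟦subst⟧ σ (A ∨' B)       I = cong₂ _∨_ (⟦subst⟧ σ A I) (⟦subst⟧ σ B I)
⟦subst⟧ σ (A ⇒' B)       I = cong₂ (λ a b → not a ∨ b) (⟦subst⟧ σ A I) (⟦subst⟧ σ B I)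

_[_≔_] : Interp → ℕ → Bool → Interp
(I [ x ≔ b ]) (var n) with n ≟ x
... | yes _ = b
... | no  _ = I (var n)
(I [ x ≔ b ]) (par p) = I (par p)

Agree-except : Atom → Interp → Interp → Set
Agree-except a I J = (b : Atom) → ¬ (b ≡ a) → I b ≡ J b

update-self : (I : Interp) (x : ℕ) → I [ x ≔ I (var x) ] ≗ I
update-self I x (par p) = refl
update-self I x (var n) with n ≟ x
... | yes refl = refl
... | no  _    = refl

update-other : (I : Interp) {x y : ℕ} (b : Bool) → y ≢ x → (I [ x ≔ b ]) (var y) ≡ I (var y)
update-other I {x} {y} b y≢x with y ≟ x
... | yes y≡x = ⊥-elim (y≢x y≡x)
... | no  _   = refl

update-cong : {I J : Interp} {x : ℕ} (b : Bool) → Agree-except (var x) I J → I [ x ≔ b ] ≗ J [ x ≔ b ]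
update-cong b I≈J (par p) = I≈J (par p) (λ ())
update-cong {x = x} b I≈J (var n) with n ≟ x
... | yes _   = refl
... | no  n≢x = I≈J (var n) (λ { refl → n≢x refl })

update-agree-except : {I J : Interp} {x : ℕ} (b : Bool) (a : Atom) →
  Agree-except a I J → Agree-except a (I [ x ≔ b ]) (J [ x ≔ b ])
update-agree-except b a I≈J (par p) p≢a = I≈J (par p) p≢a
update-agree-except {x = x} b a I≈J (var n) n≢a with n ≟ x
... | yes _ = refl
... | no  _ = I≈J (var n) n≢a

θ⊙≗update : (A : Formula) (x : ℕ) (I : Interp) → θ A x ⊙ I ≗ I [ x ≔ ⟦ A ⟧ I ∧ I (var x) ]
θ⊙≗update A x I (par p) = refl
θ⊙≗update A x I (var n) with n ≟ x
... | yes refl = refl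
... | no  _    = refl

⟦θ⟧ : (A : Formula) (x : ℕ) (I : Interp) →
  ⟦ subst (θ A x) A ⟧ I ≡ ⟦ A ⟧ (I [ x ≔ false ]) ∨ ⟦ A ⟧ (I [ x ≔ I (var x) ])
⟦θ⟧ A x I = begin
  ⟦ subst (θ A x) A ⟧ I                    ≡⟨ ⟦subst⟧ (θ A x) A I ⟩
  ⟦ A ⟧ (θ A x ⊙ I)                         ≡⟨ ⟦⟧-cong A (θ⊙≗update A x I) ⟩
  ⟦ A ⟧ (I [ x ≔ ⟦ A ⟧ I ∧ I (var x) ])     ≡⟨ cong (λ v → fibre (v ∧ I (var x))) (sym (⟦⟧-cong A (update-self I x))) ⟩
  fibre (fibre (I (var x)) ∧ I (var x))     ≡⟨ f[f∧id]≡f[false]∨f fibre (I (var x)) ⟩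
  fibre false ∨ fibre (I (var x))           ∎
  where
  open ≡-Reasoning
  fibre : Bool → Bool
  fibre b = ⟦ A ⟧ (I [ x ≔ b ])

⟦θ⟧-mono : (A : Formula) (x : ℕ) {I J : Interp} →
  (∀ b → ⟦ A ⟧ (I [ x ≔ b ]) ≤ ⟦ A ⟧ (J [ x ≔ b ])) → I (var x) ≤ J (var x) →
  ⟦ subst (θ A x) A ⟧ I ≤ ⟦ subst (θ A x) A ⟧ J
⟦θ⟧-mono A x {I} {J} fibreI≤fibreJ Ix≤Jx =
  subst₂ _≤_ (sym (⟦θ⟧ A x I)) (sym (⟦θ⟧ A x J)) (f[false]∨f-mono fibreI≤fibreJ Ix≤Jx)

lemma3p2 : (A : Formula) (x : ℕ) →
    Positive x (subst (θ A x) A) ×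
    ((y : ℕ) → Positive y A → Positive y (subst (θ A x) A))
lemma3p2 A x = x-positive , y-positive
  where
  x-positive : Positive x (subst (θ A x) A)
  x-positive I J Ix≤Jx I≈J = ⟦θ⟧-mono A x (λ b → ≤-reflexive (⟦⟧-cong A (update-cong b I≈J))) Ix≤Jx

  y-positive : (y : ℕ) → Positive y A → Positive y (subst (θ A x) A)
  y-positive y y-pos with y ≟ x
  ... | yes refl = x-positive
  ... | no  y≢x  = λ I J Iy≤Jy I≈J → ⟦θ⟧-mono A x
    (λ b → y-pos (I [ x ≔ b ]) (J [ x ≔ b ])
      (subst₂ _≤_ (sym (update-other I b y≢x)) (sym (update-other J b y≢x)) Iy≤Jy)
      (update-agree-except b (var y) I≈J))
    (≤-reflexive (I≈J (var x) λ { refl → y≢x refl }))
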